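{- Let $m$ be a positive integer, let $D$ be an $m$-automaton with output in a finite set $A$ containing $0$, and let $(a_i)_{i\ge 0}$ be the automatic sequence it generates. For $N\in\mathbb{N}$ put $E_N:=\{k\in\{1,\dots,N\} : a_k\neq 0\}$. Then exactly one of the following holds: (i) $D$ contains a tied vertex, and there exists $\alpha\in(0,1]$ such that $\# E_N\ge N^\alpha$ for all sufficiently large $N$; (ii) $D$ contains no tied vertex, and $(a_i)$ is sparse, i.e. there is $r\ge 0$ with $\# E_N=O(\log(N)^r)$.
   Context: An $m$-automaton with output in $A$ is a finite directed graph (multiple edges and loops allowed) such that: each vertex is labeled by an element of $A$; exactly one vertex is additionally labeled `Start'; each vertex has exactly $m$ outgoing edges, labeled by the distinct elements of $\{0,1,\dots,m-1\}$; an edge labeled $0$ joins two vertices with the same $A$-label (leading zero invariance); every vertex is reachable from `Start'. For $k\ge 0$ with base-$m$ expansion $k=\sum_{i=0}^n b_i m^i$, start at `Start' and follow consecutively the edges labeled $b_0,b_1,\dots,b_n$; $a_k$ is the $A$-label of the vertex reached. A walk is a sequence of edges, each starting where the previous one ends; its length is the number of edges. A vertex is "non-zero" if its $A$-label is not $0$. A vertex $v$ is tied if (1) there is a (possibly empty) walk from $v$ to a non-zero vertex, and (2) there exist two different walks of the same length from $v$ to $v$. -}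

module Defs where

open import Data.Nat using (ℕ; zero; suc; _+_; _*_; _^_; _≤_; _<_; NonZero)
open import Data.Nat.DivMod using (_%_; _/_; m%n<n)
open import Data.Nat.Logarithm using (⌊log₂_⌋)
open import Data.Fin using (Fin; toℕ; fromℕ<)
import Data.Fin as F
open import Data.List using (List; []; _∷_; length)
open import Data.Product using (Σ; ∃; ∃-syntax; _×_; _,_)
open import Relation.Binary.PropositionalEquality using (_≡_; _≢_)
open import Relation.Nullary using (¬_; yes; no)

-- An m-automaton with n vertices (Fin n) and output in the finite set
-- A = Fin (suc a), whose element 0 is F.zero.
-- Edges out of a vertex are identified by their label in {0,...,m-1}.
record Automaton (m n a : ℕ) : Set where
  field
    label   : Fin n → Fin (suc a)
    start   : Fin n
    δ       : Fin n → Fin m → Fin n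
    zeroInv : ∀ (v : Fin n) (d : Fin m) → toℕ d ≡ 0 → label (δ v d) ≡ label v

  run : Fin n → List (Fin m) → Fin n
  run v []       = v
  run v (d ∷ ds) = run (δ v d) ds

open Automaton public

AllReachable : ∀ {m n a} → Automaton m n a → Set
AllReachable D = ∀ v → ∃[ w ] run D (start D) w ≡ v

module _ {m n a : ℕ} {{_ : NonZero m}} (D : Automaton m n a) where

  digit : ℕ → Fin m
  digit k = fromℕ< (m%n<n k m)

  -- follow the base-m digits b₀, b₁, … of k starting at v (fuel-bounded; fuel k suffices)
  runDigits : ℕ → Fin n → ℕ → Fin n
  runDigits zero     v k       = v
  runDigits (suc f)  v zero    = v
  runDigits (suc f)  v (suc k) = runDigits f (δ D v (digit (suc k))) (suc k / m)

  seqA : ℕ → Fin (suc a)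
  seqA k = label D (runDigits k (start D) k)

  countE : ℕ → ℕ
  countE zero = 0
  countE (suc N) with seqA (suc N) F.≟ F.zero
  ... | yes _ = countE N
  ... | no  _ = suc (countE N)

  NonZeroVertex : Fin n → Set
  NonZeroVertex v = label D v ≢ F.zero

  Tied : Fin n → Set
  Tied v = (∃[ w ] NonZeroVertex (run D v w))
         × (∃[ w₁ ] ∃[ w₂ ] (w₁ ≢ w₂ × length w₁ ≡ length w₂
                              × run D v w₁ ≡ v × run D v w₂ ≡ v))

  HasTied : Set
  HasTied = ∃[ v ] Tied v

  -- ∃ α ∈ (0,1] with #E_N ≥ N^α for large N; α = p/q rational, N^p ≤ (#E_N)^q
  PolyGrowth : Set
  PolyGrowth = ∃[ p ] ∃[ q ] (1 ≤ p × p ≤ q ×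
                 ∃[ N₀ ] ∀ N → N₀ ≤ N → N ^ p ≤ countE N ^ q)

  Sparse : Set
  Sparse = ∃[ r ] ∃[ C ] ∃[ N₀ ] ∀ N → N₀ ≤ N → countE N ≤ C * ⌊log₂ N ⌋ ^ r

  Case-i : Set
  Case-i = HasTied × PolyGrowth

  Case-ii : Set
  Case-ii = (¬ HasTied) × Sparse

{-# OPTIONS --safe #-}

-- Let W(v, L) be the number of walks of length L from v that end in a non-zero vertex.
-- Since an edge labelled 0 preserves the output, the base-m expansions of the k < m^L,
-- padded with zeros to length L, show W(Start, L) = #{k < m^L : a_k ≠ 0}; so #E_N lies
-- between W(Start, L) - 1 and W(Start, L') whenever m^L ≤ N + 1 ≤ m^L'.
--
-- If v is tied, with a walk w from v to a non-zero vertex and two different closed walks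
-- c₁, c₂ of length ℓ at v, then W(v, (j + 1)ℓ + |w|) ≥ 2 W(v, jℓ + |w|): W doubles every
-- ℓ steps, hence #E_N ≥ N^(1/q) for some q.
--
-- If no vertex is tied, then from a vertex x that can still reach a non-zero vertex at most
-- one edge leads back to x; every other edge strictly shrinks the set of reachable vertices.
-- Induction on the size k of that set gives W(x, L) ≤ (m (L + 1))^k, so #E_N = O(log(N)^n)
-- for n the number of vertices.
--
-- The dichotomy is constructive because being tied is decidable: v is tied iff some walk
-- from v reaches a non-zero vertex and two different edges out of some vertex reachable
-- from v both lead back to v.

module Submission where

open import Defs
open import Data.Bool.Properties using (T-≡)
open import Data.Fin as Fin using (Fin; zero; suc; toℕ; punchIn; punchOut)
open import Data.Fin.Properties
  using (any?; pigeonhole; toℕ<n; toℕ≤pred[n]; toℕ-fromℕ<; fromℕ<-cong; fromℕ<-toℕ;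
         punchIn-punchOut; punchInᵢ≢i)
open import Data.Fin.Subset using (Subset; _∈_; _⊆_; _⊂_; ∣_∣; ⁅_⁆)
open import Data.Fin.Subset.Properties
  using (p⊆q⇒∣p∣≤∣q∣; p⊂q⇒∣p∣<∣q∣; ∣⁅x⁆∣≡1; x∈⁅y⁆⇒x≡y; ∣p∣≤n)
open import Data.List using (List; []; _∷_; _++_; length; take; drop)
open import Data.List.Properties
  using (length-++; length-take; length-drop; take++drop≡id; ++-assoc; ++-cancelˡ; ∷-injectiveˡ)
open import Data.Nat
open import Data.Nat.DivMod
open import Data.Nat.Divisibility using (divides)
open import Data.Nat.Logarithm using (⌊log₂_⌋; ⌊log₂⌋-mono-≤; ⌊log₂[2^n]⌋≡n)
open import Data.Nat.Properties
open import Data.Nat.Solver using (module +-*-Solver)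
open import Data.Product using (∃-syntax; _×_; _,_; proj₁)
open import Data.Sum using (_⊎_; inj₁; inj₂)
open import Data.Vec using (tabulate)
open import Data.Vec.Functional using (removeAt)
open import Data.Vec.Properties using (lookup∘tabulate; []=⇒lookup; lookup⇒[]=)
open import Function using (_∘_)
open import Function.Bundles using (Equivalence)
open import Relation.Binary.PropositionalEquality
open import Relation.Nullary using (¬_; Dec; yes; no; contradiction)
open import Relation.Nullary.Decidable using (_⊎-dec_; _×-dec_; ¬?; map′; isYes; fromWitness; toWitness)
open import Relation.Unary using (Decidable)
open import Algebra.Properties.CommutativeMonoid.Sum +-0-commutativeMonoid
  using (sum; sum-syntax; sum-remove; sum-cong-≗; sum-replicate-zero; ∑-distrib-+)
open import Algebra.Properties.CommutativeSemigroup *-commutativeSemigroup using (interchange)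

∑≤*-bound : ∀ {k b} {f : Fin k → ℕ} → (∀ i → f i ≤ b) → sum f ≤ k * b
∑≤*-bound {zero}  f≤b = z≤n
∑≤*-bound {suc k} f≤b = +-mono-≤ (f≤b zero) (∑≤*-bound (f≤b ∘ suc))

term≤∑ : ∀ {k} (f : Fin k → ℕ) i → f i ≤ sum f
term≤∑ {suc k} f i = ≤-trans (m≤m+n (f i) _) (≤-reflexive (sym (sum-remove f)))

twoTerms≤∑ : ∀ {k} (f : Fin k → ℕ) {i j} → i ≢ j → f i + f j ≤ sum f
twoTerms≤∑ {suc k} f {i} {j} i≢j = begin
  f i + f j                         ≡⟨ cong (λ l → f i + f l) (punchIn-punchOut i≢j) ⟨
  f i + removeAt f i (punchOut i≢j) ≤⟨ +-monoʳ-≤ (f i) (term≤∑ (removeAt f i) _) ⟩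
  f i + sum (removeAt f i)          ≡⟨ sum-remove f ⟨
  sum f                             ∎
  where open ≤-Reasoning

∑≤-oneException : ∀ {k a b} {P : Fin k → Set} {f : Fin k → ℕ} → Decidable P →
  (∀ {i j} → P i → P j → i ≡ j) → (∀ i → P i → f i ≤ a) → (∀ i → ¬ P i → f i ≤ b) →
  sum f ≤ a + k * b
∑≤-oneException {k} {a} {b} {P} {f} P? unique fa fb with any? P?
... | no ∄P = ≤-trans (∑≤*-bound (λ i → fb i (∄P ∘ (i ,_)))) (m≤n+m (k * b) a)
∑≤-oneException {suc k} {a} {b} {P} {f} P? unique fa fb | yes (e , Pe) = begin
  sum f                    ≡⟨ sum-remove f ⟩
  f e + sum (removeAt f e) ≤⟨ +-mono-≤ (fa e Pe) (∑≤*-bound others) ⟩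
  a + k * b                ≤⟨ +-monoʳ-≤ a (m≤n+m (k * b) b) ⟩
  a + suc k * b            ∎
  where
  open ≤-Reasoning
  others : ∀ i → f (punchIn e i) ≤ b
  others i = fb (punchIn e i) (λ P[eᵢ] → punchInᵢ≢i e i (unique P[eᵢ] Pe))

sumBelow : ℕ → (ℕ → ℕ) → ℕ
sumBelow N f = ∑[ i < N ] f (toℕ i)

sumBelow-cong : ∀ N {f g : ℕ → ℕ} → (∀ i → i < N → f i ≡ g i) → sumBelow N f ≡ sumBelow N g
sumBelow-cong N f≡g = sum-cong-≗ (λ i → f≡g (toℕ i) (toℕ<n i))

sumBelow-suc : ∀ N (f : ℕ → ℕ) → sumBelow (suc N) f ≡ sumBelow N f + f N
sumBelow-suc zero    f = +-comm (f 0) 0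
sumBelow-suc (suc N) f = trans (cong (f 0 +_) (sumBelow-suc N (f ∘ suc))) (sym (+-assoc (f 0) _ _))

sumBelow-+ : ∀ M N (f : ℕ → ℕ) → sumBelow (M + N) f ≡ sumBelow M f + sumBelow N (λ i → f (M + i))
sumBelow-+ zero    N f = refl
sumBelow-+ (suc M) N f = trans (cong (f 0 +_) (sumBelow-+ M N (f ∘ suc))) (sym (+-assoc (f 0) _ _))

sumBelow-mono : ∀ {M N} (f : ℕ → ℕ) → M ≤ N → sumBelow M f ≤ sumBelow N f
sumBelow-mono {M} f M≤N with m≤n⇒∃[o]m+o≡n M≤N
... | o , refl = ≤-trans (m≤m+n _ _) (≤-reflexive (sym (sumBelow-+ M o f)))

sumBelow-* : ∀ M k (f : ℕ → ℕ) →
  sumBelow (M * k) f ≡ ∑[ r < k ] sumBelow M (λ q → f (toℕ r + q * k))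
sumBelow-* zero    k f = sym (sum-replicate-zero k)
sumBelow-* (suc M) k f = begin
  sumBelow (k + M * k) f
    ≡⟨ sumBelow-+ k (M * k) f ⟩
  sumBelow k f + sumBelow (M * k) (λ i → f (k + i))
    ≡⟨ cong₂ _+_ (sum-cong-≗ {k} λ r → cong f (sym (+-identityʳ (toℕ r))))
                 (trans (sumBelow-* M k (λ i → f (k + i)))
                        (sum-cong-≗ {k} λ r → sumBelow-cong M λ q _ → cong f (shift (toℕ r) q))) ⟩
  ∑[ r < k ] f (toℕ r + 0) + ∑[ r < k ] sumBelow M (λ q → f (toℕ r + suc q * k))
    ≡⟨ ∑-distrib-+ {k} (λ r → f (toℕ r + 0)) (λ r → sumBelow M (λ q → f (toℕ r + suc q * k))) ⟨
  ∑[ r < k ] sumBelow (suc M) (λ q → f (toℕ r + q * k)) ∎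
  where
  open ≡-Reasoning
  shift : ∀ r q → k + (r + q * k) ≡ r + suc q * k
  shift r q = trans (sym (+-assoc k r _)) (trans (cong (_+ q * k) (+-comm k r)) (+-assoc r k _))

1≤2^ : ∀ k → 1 ≤ 2 ^ k
1≤2^ k = m^n>0 2 k

n<2^n : ∀ k → k < 2 ^ k
n<2^n zero    = s≤s z≤n
n<2^n (suc k) = +-mono-≤ (1≤2^ k) (≤-trans (n<2^n k) (m≤m+n (2 ^ k) 0))

n<2^[1+⌊log₂n⌋] : ∀ N → N < 2 ^ suc ⌊log₂ N ⌋
n<2^[1+⌊log₂n⌋] N = ≰⇒> λ 2^[1+ℓ]≤N →
  1+n≰n (subst (_≤ ⌊log₂ N ⌋) (⌊log₂[2^n]⌋≡n (suc ⌊log₂ N ⌋)) (⌊log₂⌋-mono-≤ 2^[1+ℓ]≤N))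

^-distribʳ-* : ∀ x y k → (x * y) ^ k ≡ x ^ k * y ^ k
^-distribʳ-* x y zero    = refl
^-distribʳ-* x y (suc k) = trans (cong (x * y *_) (^-distribʳ-* x y k)) (interchange x y (x ^ k) (y ^ k))

-- Polynomial growth from repeated doubling

blockwise : ∀ {P : ℕ → Set} (b : ℕ → ℕ) → (∀ N → N < b N) →
  (∀ i {N} → b i ≤ N → N < b (suc i) → P N) → ∀ {N} → b 0 ≤ N → P N
blockwise {P} b N<b[N] onBlock {N} b₀≤N = below N (N<b[N] N)
  where
  below : ∀ i → N < b i → P N
  below zero    N<b₀ = contradiction b₀≤N (<⇒≱ N<b₀)
  below (suc i) N<bᵢ₊₁ with N <? b i
  ... | yes N<bᵢ = below i N<bᵢ
  ... | no  N≮bᵢ = onBlock i (≮⇒≥ N≮bᵢ) N<bᵢ₊₁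

module _ {m} (m≥2 : 2 ≤ m) (E : ℕ → ℕ) (c ℓ : ℕ) (ℓ≥1 : 1 ≤ ℓ)
         (doubling : ∀ j N → m ^ (c + j * ℓ) ≤ suc N → 2 ^ j ≤ suc (E N)) where

  private
    instance
      m≢0 : NonZero m
      m≢0 = >-nonZero (≤-trans (s≤s z≤n) m≥2)
      ℓ≢0 : NonZero ℓ
      ℓ≢0 = >-nonZero ℓ≥1

    X = c + 3 * ℓ

    ℓ≤X : ℓ ≤ X
    ℓ≤X = ≤-trans (m≤m+n ℓ (2 * ℓ)) (m≤n+m (3 * ℓ) c)

    b : ℕ → ℕ
    b i = m ^ (c + (2 + i) * ℓ)

    N<b[N] : ∀ N → N < b N
    N<b[N] N = begin-strict
      N                     <⟨ n<2^n N ⟩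
      2 ^ N                 ≤⟨ ^-monoˡ-≤ N m≥2 ⟩
      m ^ N                 ≤⟨ ^-monoʳ-≤ m (≤-trans (≤-trans (m≤n+m N 2) (m≤m*n (2 + N) ℓ)) (m≤n+m _ c)) ⟩
      m ^ (c + (2 + N) * ℓ) ∎
      where open ≤-Reasoning

    2^[1+i]≤E : ∀ i {N} → b i ≤ N → 2 ^ suc i ≤ E N
    2^[1+i]≤E i b≤N = +-cancelˡ-≤ 1 _ _ (begin
      1 + 2 ^ suc i         ≤⟨ +-monoˡ-≤ _ (1≤2^ (suc i)) ⟩
      2 ^ suc i + 2 ^ suc i ≡⟨ cong (2 ^ suc i +_) (+-identityʳ _) ⟨
      2 ^ (2 + i)           ≤⟨ doubling (2 + i) _ (m≤n⇒m≤1+n b≤N) ⟩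
      suc (E _)             ∎)
      where open ≤-Reasoning

    exponent≤ : ∀ i → m * (c + (3 + i) * ℓ) ≤ suc i * (m * X)
    exponent≤ i = begin
      m * (c + (3 + i) * ℓ)
        ≡⟨ cong (m *_) (solve 3 (λ c ℓ i → c :+ (con 3 :+ i) :* ℓ := (c :+ con 3 :* ℓ) :+ i :* ℓ) refl c ℓ i) ⟩
      m * (X + i * ℓ)
        ≤⟨ *-monoʳ-≤ m (+-monoʳ-≤ X (*-monoʳ-≤ i ℓ≤X)) ⟩
      m * (X + i * X)
        ≡⟨ solve 3 (λ m i X → m :* (X :+ i :* X) := (con 1 :+ i) :* (m :* X)) refl m i X ⟩
      suc i * (m * X) ∎
      where
      open ≤-Reasoning
      open +-*-Solver

  -- q = m X works because on the block b i ≤ N < b (1 + i) both 2^(1 + i) ≤ E N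
  -- and N < 2^((1 + i) q).
  polyGrowth-from-doubling : ∃[ q ] 1 ≤ q × ∃[ N₀ ] ∀ N → N₀ ≤ N → N ≤ E N ^ q
  polyGrowth-from-doubling = m * X , *-mono-≤ (≤-trans (s≤s z≤n) m≥2) (≤-trans ℓ≥1 ℓ≤X) , b 0 ,
                             λ N → blockwise b N<b[N] onBlock
    where
    onBlock : ∀ i {N} → b i ≤ N → N < b (suc i) → N ≤ E N ^ (m * X)
    onBlock i {N} b≤N N<b = <⇒≤ (begin-strict
      N                           <⟨ N<b ⟩
      m ^ (c + (3 + i) * ℓ)       ≤⟨ ^-monoˡ-≤ (c + (3 + i) * ℓ) (<⇒≤ (n<2^n m)) ⟩
      (2 ^ m) ^ (c + (3 + i) * ℓ) ≡⟨ ^-*-assoc 2 m _ ⟩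
      2 ^ (m * (c + (3 + i) * ℓ)) ≤⟨ ^-monoʳ-≤ 2 (exponent≤ i) ⟩
      2 ^ (suc i * (m * X))       ≡⟨ ^-*-assoc 2 (suc i) (m * X) ⟨
      (2 ^ suc i) ^ (m * X)       ≤⟨ ^-monoˡ-≤ (m * X) (2^[1+i]≤E i b≤N) ⟩
      E N ^ (m * X)               ∎)
      where open ≤-Reasoning

-- Walks, reachability and tied vertices

≢-sameLength⇒nonempty : ∀ {A : Set} {xs ys : List A} → xs ≢ ys → length xs ≡ length ys → 1 ≤ length xs
≢-sameLength⇒nonempty {xs = []}    {[]} xs≢ys _ = contradiction refl xs≢ys
≢-sameLength⇒nonempty {xs = _ ∷ _}      _     _ = s≤s z≤n

module _ {m n a} {{_ : NonZero m}} (D : Automaton m n a) where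

  Word : Set
  Word = List (Fin m)

  s₀ : Fin n
  s₀ = start D

  run-++ : ∀ v (u w : Word) → run D v (u ++ w) ≡ run D (run D v u) w
  run-++ v []      w = refl
  run-++ v (d ∷ u) w = run-++ (δ D v d) u w

  Reach : Fin n → Fin n → Set
  Reach x y = ∃[ w ] run D x w ≡ y

  Reach-refl : ∀ {x} → Reach x x
  Reach-refl = [] , refl

  Reach-trans : ∀ {x y z} → Reach x y → Reach y z → Reach x z
  Reach-trans {x} (u , refl) (w , refl) = u ++ w , run-++ x u w

  run-cutLoop : ∀ v (w : Word) {i j} → i < j → j ≤ length w →
    run D v (take i w) ≡ run D v (take j w) →
    length (take i w ++ drop j w) < length w × run D v (take i w ++ drop j w) ≡ run D v w
  run-cutLoop v w {i} {j} i<j j≤|w| loop = shorter , sameEnd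
    where
    shorter : length (take i w ++ drop j w) < length w
    shorter = begin-strict
      length (take i w ++ drop j w)         ≡⟨ length-++ (take i w) ⟩
      length (take i w) + length (drop j w) ≡⟨ cong₂ _+_ (length-take i w) (length-drop j w) ⟩
      i ⊓ length w + (length w ∸ j)         ≤⟨ +-monoˡ-≤ _ (m⊓n≤m i (length w)) ⟩
      i + (length w ∸ j)                    <⟨ +-monoˡ-< _ i<j ⟩
      j + (length w ∸ j)                    ≡⟨ m+[n∸m]≡n j≤|w| ⟩
      length w                              ∎
      where open ≤-Reasoning
    sameEnd : run D v (take i w ++ drop j w) ≡ run D v w
    sameEnd = begin
      run D v (take i w ++ drop j w)        ≡⟨ run-++ v (take i w) (drop j w) ⟩
      run D (run D v (take i w)) (drop j w) ≡⟨ cong (λ x → run D x (drop j w)) loop ⟩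
      run D (run D v (take j w)) (drop j w) ≡⟨ run-++ v (take j w) (drop j w) ⟨
      run D v (take j w ++ drop j w)        ≡⟨ cong (run D v) (take++drop≡id j w) ⟩
      run D v w                             ∎
      where open ≡-Reasoning

  -- Among the n + 1 prefixes of length ≤ n of a longer walk two end at the same vertex.
  shortWalk : ∀ v (w : Word) → ∃[ u ] length u ≤ n × run D v u ≡ run D v w
  shortWalk v w = go (length w) w ≤-refl
    where
    go : ∀ L (w : Word) → length w ≤ L → ∃[ u ] length u ≤ n × run D v u ≡ run D v w
    go L w |w|≤L with length w ≤? n
    ... | yes |w|≤n = w , |w|≤n , refl
    go zero    [] _ | no |w|≰n = contradiction z≤n |w|≰n
    go (suc L) w |w|≤L | no |w|≰n
      with pigeonhole ≤-refl (λ (i : Fin (suc n)) → run D v (take (toℕ i) w))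
    ... | i , j , i<j , loop with run-cutLoop v w i<j j≤|w| loop
      where j≤|w| = ≤-trans (toℕ≤pred[n] j) (<⇒≤ (≰⇒> |w|≰n))
    ... | shorter , sameEnd
      with go L (take (toℕ i) w ++ drop (toℕ j) w) (≤-pred (≤-trans shorter |w|≤L))
    ... | u , |u|≤n , u≡ = u , |u|≤n , trans u≡ sameEnd

  ReachWithin : ℕ → Fin n → Fin n → Set
  ReachWithin zero    x y = x ≡ y
  ReachWithin (suc k) x y = x ≡ y ⊎ ∃[ d ] ReachWithin k (δ D x d) y

  reachWithin? : ∀ k x y → Dec (ReachWithin k x y)
  reachWithin? zero    x y = x Fin.≟ y
  reachWithin? (suc k) x y = (x Fin.≟ y) ⊎-dec any? (λ d → reachWithin? k (δ D x d) y)

  reachWithin⇒reach : ∀ k {x y} → ReachWithin k x y → Reach x y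
  reachWithin⇒reach zero    x≡y            = [] , x≡y
  reachWithin⇒reach (suc k) (inj₁ x≡y)     = [] , x≡y
  reachWithin⇒reach (suc k) (inj₂ (d , r)) with reachWithin⇒reach k r
  ... | w , w↝y = d ∷ w , w↝y

  walk⇒reachWithin : ∀ {k} x (w : Word) → length w ≤ k → ReachWithin k x (run D x w)
  walk⇒reachWithin {zero}  x []      _             = refl
  walk⇒reachWithin {suc k} x []      _             = inj₁ refl
  walk⇒reachWithin {suc k} x (d ∷ w) (s≤s |w|≤k) = inj₂ (d , walk⇒reachWithin (δ D x d) w |w|≤k)

  reach? : ∀ x y → Dec (Reach x y)
  reach? x y with reachWithin? n x y
  ... | yes r = yes (reachWithin⇒reach n r)
  ... | no ¬r = no λ (w , w↝y) → let (u , |u|≤n , u≡w) = shortWalk x w in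
                  ¬r (subst (ReachWithin n x) (trans u≡w w↝y) (walk⇒reachWithin x u |u|≤n))

  reachable : Fin n → Subset n
  reachable x = tabulate (λ y → isYes (reach? x y))

  ∈reachable⁺ : ∀ {x y} → Reach x y → y ∈ reachable x
  ∈reachable⁺ {x} {y} x↝y =
    lookup⇒[]= y (reachable x) (trans (lookup∘tabulate _ y) (Equivalence.to T-≡ (fromWitness x↝y)))

  ∈reachable⁻ : ∀ {x y} → y ∈ reachable x → Reach x y
  ∈reachable⁻ {x} {y} y∈R =
    toWitness (Equivalence.from T-≡ (trans (sym (lookup∘tabulate _ y)) ([]=⇒lookup y∈R)))

  reachable-⊆ : ∀ {x y} → Reach x y → reachable y ⊆ reachable x
  reachable-⊆ x↝y z∈R = ∈reachable⁺ (Reach-trans x↝y (∈reachable⁻ z∈R))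

  reachable-⊂ : ∀ {x y} → Reach x y → ¬ Reach y x → reachable y ⊂ reachable x
  reachable-⊂ {x} x↝y ¬y↝x = reachable-⊆ x↝y , x , ∈reachable⁺ Reach-refl , ¬y↝x ∘ ∈reachable⁻

  1≤∣reachable∣ : ∀ x → 1 ≤ ∣ reachable x ∣
  1≤∣reachable∣ x = subst (_≤ ∣ reachable x ∣) (∣⁅x⁆∣≡1 x) (p⊆q⇒∣p∣≤∣q∣ ⁅x⁆⊆R)
    where
    ⁅x⁆⊆R : ⁅ x ⁆ ⊆ reachable x
    ⁅x⁆⊆R y∈⁅x⁆ = subst (_∈ reachable x) (sym (x∈⁅y⁆⇒x≡y x y∈⁅x⁆)) (∈reachable⁺ Reach-refl)

  Live : Fin n → Set
  Live v = ∃[ w ] NonZeroVertex D (run D v w)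

  live? : ∀ v → Dec (Live v)
  live? v = map′ (λ (y , (w , w↝y) , y≢0) → w , subst (NonZeroVertex D) (sym w↝y) y≢0)
                 (λ (w , w≢0) → run D v w , (w , refl) , w≢0)
                 (any? λ y → reach? v y ×-dec ¬? (label D y Fin.≟ zero))

  Fork : Fin n → Set
  Fork v = ∃[ x ] ∃[ d₁ ] ∃[ d₂ ] d₁ ≢ d₂ × Reach v x × Reach (δ D x d₁) v × Reach (δ D x d₂) v

  fork? : ∀ v → Dec (Fork v)
  fork? v = any? λ x → any? λ d₁ → any? λ d₂ →
    ¬? (d₁ Fin.≟ d₂) ×-dec reach? v x ×-dec reach? (δ D x d₁) v ×-dec reach? (δ D x d₂) v

  live∧fork⇒tied : ∀ {v} → Live v → Fork v → Tied D v
  live∧fork⇒tied {v} live (x , d₁ , d₂ , d₁≢d₂ , (p , p↝x) , (c₁ , c₁↝v) , (c₂ , c₂↝v)) =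
    live , C₁ ++ C₂ , C₂ ++ C₁ , different , sameLength , closed C₁ C₂ C₁↺ C₂↺ , closed C₂ C₁ C₂↺ C₁↺
    where
    C₁ = p ++ d₁ ∷ c₁
    C₂ = p ++ d₂ ∷ c₂
    cycle : ∀ d c → run D (δ D x d) c ≡ v → run D v (p ++ d ∷ c) ≡ v
    cycle d c c↝v = trans (run-++ v p (d ∷ c)) (trans (cong (λ y → run D y (d ∷ c)) p↝x) c↝v)
    C₁↺ = cycle d₁ c₁ c₁↝v
    C₂↺ = cycle d₂ c₂ c₂↝v
    closed : ∀ A B → run D v A ≡ v → run D v B ≡ v → run D v (A ++ B) ≡ v
    closed A B A↺ B↺ = trans (run-++ v A B) (trans (cong (λ y → run D y B) A↺) B↺)
    different : C₁ ++ C₂ ≢ C₂ ++ C₁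
    different eq = d₁≢d₂ (∷-injectiveˡ (++-cancelˡ p (d₁ ∷ c₁ ++ C₂) (d₂ ∷ c₂ ++ C₁)
      (trans (sym (++-assoc p (d₁ ∷ c₁) C₂)) (trans eq (++-assoc p (d₂ ∷ c₂) C₁)))))
    sameLength : length (C₁ ++ C₂) ≡ length (C₂ ++ C₁)
    sameLength = trans (length-++ C₁) (trans (+-comm (length C₁) _) (sym (length-++ C₂)))

  divergingWalks⇒fork : ∀ {v y} (w₁ w₂ : Word) → w₁ ≢ w₂ → length w₁ ≡ length w₂ →
    run D y w₁ ≡ v → run D y w₂ ≡ v → Reach v y → Fork v
  divergingWalks⇒fork []        []        w₁≢w₂ _ _ _ _ = contradiction refl w₁≢w₂
  divergingWalks⇒fork {y = y} (d₁ ∷ w₁) (d₂ ∷ w₂) w₁≢w₂ |w₁|≡|w₂| w₁↝v w₂↝v v↝y with d₁ Fin.≟ d₂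
  ... | yes refl = divergingWalks⇒fork w₁ w₂ (w₁≢w₂ ∘ cong (d₁ ∷_)) (suc-injective |w₁|≡|w₂|)
                     w₁↝v w₂↝v (Reach-trans v↝y (d₁ ∷ [] , refl))
  ... | no d₁≢d₂ = y , d₁ , d₂ , d₁≢d₂ , v↝y , (w₁ , w₁↝v) , (w₂ , w₂↝v)

  tied⇒fork : ∀ {v} → Tied D v → Fork v
  tied⇒fork (_ , w₁ , w₂ , w₁≢w₂ , |w₁|≡|w₂| , w₁↺ , w₂↺) =
    divergingWalks⇒fork w₁ w₂ w₁≢w₂ |w₁|≡|w₂| w₁↺ w₂↺ Reach-refl

  hasTied? : Dec (HasTied D)
  hasTied? = map′ (λ (v , live , fork) → v , live∧fork⇒tied live fork)
                  (λ (v , tied) → v , proj₁ tied , tied⇒fork tied)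
                  (any? λ v → live? v ×-dec fork? v)

  -- Counting walks that end at a non-zero vertex

  [_≢0] : Fin (suc a) → ℕ
  [ zero  ≢0] = 0
  [ suc _ ≢0] = 1

  [≢0]≤1 : (c : Fin (suc a)) → [ c ≢0] ≤ 1
  [≢0]≤1 zero    = z≤n
  [≢0]≤1 (suc _) = s≤s z≤n

  [≢0]≡0 : ∀ {c : Fin (suc a)} → ¬ c ≢ zero → [ c ≢0] ≡ 0
  [≢0]≡0 {c = zero}  _    = refl
  [≢0]≡0 {c = suc _} ¬c≢0 = contradiction (λ ()) ¬c≢0

  [≢0]≡1 : ∀ {c : Fin (suc a)} → c ≢ zero → [ c ≢0] ≡ 1
  [≢0]≡1 {c = zero}  c≢0 = contradiction refl c≢0
  [≢0]≡1 {c = suc _} _   = refl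

  #nonzeroWalks : Fin n → ℕ → ℕ
  #nonzeroWalks v zero    = [ label D v ≢0]
  #nonzeroWalks v (suc L) = ∑[ d < m ] #nonzeroWalks (δ D v d) L

  #nonzeroWalks-run : ∀ v (w : Word) L → #nonzeroWalks (run D v w) L ≤ #nonzeroWalks v (length w + L)
  #nonzeroWalks-run v []      L = ≤-refl
  #nonzeroWalks-run v (d ∷ w) L =
    ≤-trans (#nonzeroWalks-run (δ D v d) w L) (term≤∑ (λ d → #nonzeroWalks (δ D v d) (length w + L)) d)

  #nonzeroWalks-twoRuns : ∀ v (w₁ w₂ : Word) L → w₁ ≢ w₂ → length w₁ ≡ length w₂ →
    #nonzeroWalks (run D v w₁) L + #nonzeroWalks (run D v w₂) L ≤ #nonzeroWalks v (length w₁ + L)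
  #nonzeroWalks-twoRuns v []        []        L w₁≢w₂ _ = contradiction refl w₁≢w₂
  #nonzeroWalks-twoRuns v (d₁ ∷ w₁) (d₂ ∷ w₂) L w₁≢w₂ |dw₁|≡|dw₂| with d₁ Fin.≟ d₂
  ... | yes refl = ≤-trans
    (#nonzeroWalks-twoRuns (δ D v d₁) w₁ w₂ L (w₁≢w₂ ∘ cong (d₁ ∷_)) (suc-injective |dw₁|≡|dw₂|))
    (term≤∑ (λ d → #nonzeroWalks (δ D v d) (length w₁ + L)) d₁)
  ... | no d₁≢d₂ = begin
    #nonzeroWalks (run D v₁ w₁) L + #nonzeroWalks (run D v₂ w₂) L
      ≤⟨ +-mono-≤ (#nonzeroWalks-run v₁ w₁ L) (#nonzeroWalks-run v₂ w₂ L) ⟩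
    #nonzeroWalks v₁ (length w₁ + L) + #nonzeroWalks v₂ (length w₂ + L)
      ≡⟨ cong (λ k → #nonzeroWalks v₁ (length w₁ + L) + #nonzeroWalks v₂ (k + L))
              (suc-injective |dw₁|≡|dw₂|) ⟨
    #nonzeroWalks v₁ (length w₁ + L) + #nonzeroWalks v₂ (length w₁ + L)
      ≤⟨ twoTerms≤∑ (λ d → #nonzeroWalks (δ D v d) (length w₁ + L)) d₁≢d₂ ⟩
    #nonzeroWalks v (suc (length w₁) + L) ∎
    where
    open ≤-Reasoning
    v₁ = δ D v d₁
    v₂ = δ D v d₂

  #nonzeroWalks-dead : ∀ {x} → ¬ Live x → ∀ L → #nonzeroWalks x L ≡ 0
  #nonzeroWalks-dead {x} dead zero    = [≢0]≡0 (λ x≢0 → dead ([] , x≢0))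
  #nonzeroWalks-dead {x} dead (suc L) =
    trans (sum-cong-≗ {m} λ d → #nonzeroWalks-dead (λ (w , w≢0) → dead (d ∷ w , w≢0)) L)
          (sum-replicate-zero m)

  doubling : ∀ {v} (w c₁ c₂ : Word) → NonZeroVertex D (run D v w) →
    length c₁ ≡ length c₂ → c₁ ≢ c₂ → run D v c₁ ≡ v → run D v c₂ ≡ v →
    ∀ j → 2 ^ j ≤ #nonzeroWalks v (j * length c₁ + length w)
  doubling {v} w c₁ c₂ w≢0 _ _ _ _ zero = begin
    1                                 ≡⟨ [≢0]≡1 w≢0 ⟨
    #nonzeroWalks (run D v w) 0       ≤⟨ #nonzeroWalks-run v w 0 ⟩
    #nonzeroWalks v (length w + 0)    ≡⟨ cong (#nonzeroWalks v) (+-identityʳ (length w)) ⟩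
    #nonzeroWalks v (length w)        ∎
    where open ≤-Reasoning
  doubling {v} w c₁ c₂ w≢0 |c₁|≡|c₂| c₁≢c₂ c₁↺ c₂↺ (suc j) = begin
    2 ^ j + (2 ^ j + 0)
      ≡⟨ cong (2 ^ j +_) (+-identityʳ _) ⟩
    2 ^ j + 2 ^ j
      ≤⟨ +-mono-≤ IH IH ⟩
    #nonzeroWalks v R + #nonzeroWalks v R
      ≡⟨ cong₂ (λ x y → #nonzeroWalks x R + #nonzeroWalks y R) c₁↺ c₂↺ ⟨
    #nonzeroWalks (run D v c₁) R + #nonzeroWalks (run D v c₂) R
      ≤⟨ #nonzeroWalks-twoRuns v c₁ c₂ R c₁≢c₂ |c₁|≡|c₂| ⟩
    #nonzeroWalks v (length c₁ + R)
      ≡⟨ cong (#nonzeroWalks v) (+-assoc (length c₁) _ _) ⟨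
    #nonzeroWalks v (suc j * length c₁ + length w) ∎
    where
    open ≤-Reasoning
    R = j * length c₁ + length w
    IH = doubling w c₁ c₂ w≢0 |c₁|≡|c₂| c₁≢c₂ c₁↺ c₂↺ j

  walkGrowth-step : ∀ k L → (m * suc L) ^ suc k + m * (m * suc L) ^ k ≤ (m * suc (suc L)) ^ suc k
  walkGrowth-step k L = begin
    Y * Y ^ k + m * Y ^ k ≡⟨ *-distribʳ-+ (Y ^ k) Y m ⟨
    (Y + m) * Y ^ k       ≡⟨ cong (_* Y ^ k) (trans (+-comm Y m) (sym (*-suc m (suc L)))) ⟩
    Z * Y ^ k             ≤⟨ *-monoʳ-≤ Z (^-monoˡ-≤ k (*-monoʳ-≤ m (n≤1+n (suc L)))) ⟩
    Z * Z ^ k             ∎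
    where
    open ≤-Reasoning
    Y = m * suc L
    Z = m * suc (suc L)

  module _ (untied : ¬ HasTied D) where

    returnEdge-unique : ∀ {x} → Live x → ∀ {d₁ d₂} → Reach (δ D x d₁) x → Reach (δ D x d₂) x → d₁ ≡ d₂
    returnEdge-unique {x} live {d₁} {d₂} d₁↝x d₂↝x with d₁ Fin.≟ d₂
    ... | yes d₁≡d₂ = d₁≡d₂
    ... | no  d₁≢d₂ =
      contradiction (x , live∧fork⇒tied live (x , d₁ , d₂ , d₁≢d₂ , Reach-refl , d₁↝x , d₂↝x)) untied

    #nonzeroWalks-untied : ∀ k L x → ∣ reachable x ∣ ≤ k → #nonzeroWalks x L ≤ (m * suc L) ^ k
    #nonzeroWalks-untied zero    L       x ∣R∣≤0 = contradiction (≤-trans (1≤∣reachable∣ x) ∣R∣≤0) λ ()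
    #nonzeroWalks-untied (suc k) zero    x _     =
      ≤-trans ([≢0]≤1 (label D x)) (m^n>0 (m * 1) {{m*n≢0 m 1}} (suc k))
    #nonzeroWalks-untied (suc k) (suc L) x ∣R∣≤k with live? x
    ... | no  dead = ≤-trans (≤-reflexive (#nonzeroWalks-dead dead (suc L))) z≤n
    ... | yes live = ≤-trans
      (∑≤-oneException (λ d → reach? (δ D x d) x) (returnEdge-unique live) returning leaving)
      (walkGrowth-step k L)
      where
      x↝δx : ∀ d → Reach x (δ D x d)
      x↝δx d = d ∷ [] , refl
      returning : ∀ d → Reach (δ D x d) x → #nonzeroWalks (δ D x d) L ≤ (m * suc L) ^ suc k
      returning d _ =
        #nonzeroWalks-untied (suc k) L (δ D x d) (≤-trans (p⊆q⇒∣p∣≤∣q∣ (reachable-⊆ (x↝δx d))) ∣R∣≤k)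
      leaving : ∀ d → ¬ Reach (δ D x d) x → #nonzeroWalks (δ D x d) L ≤ (m * suc L) ^ k
      leaving d ¬δx↝x =
        #nonzeroWalks-untied k L (δ D x d)
          (≤-pred (≤-trans (p⊂q⇒∣p∣<∣q∣ (reachable-⊂ (x↝δx d) ¬δx↝x)) ∣R∣≤k))

  -- Walk counts and the automatic sequence

  digits : ℕ → ℕ → Word
  digits zero    k = []
  digits (suc L) k = digit D k ∷ digits L (k / m)

  digit-+* : ∀ (r : Fin m) q → digit D (toℕ r + q * m) ≡ r
  digit-+* r q = trans (fromℕ<-cong _ _ r+qm%m≡r _ (toℕ<n r)) (fromℕ<-toℕ r (toℕ<n r))
    where
    r+qm%m≡r : (toℕ r + q * m) % m ≡ toℕ r
    r+qm%m≡r = trans ([m+kn]%n≡m%n (toℕ r) q m) (m<n⇒m%n≡m (toℕ<n r))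

  /-+* : ∀ (r : Fin m) q → (toℕ r + q * m) / m ≡ q
  /-+* r q = trans (+-distrib-/-∣ʳ (toℕ r) (divides q refl))
                   (cong₂ _+_ (m<n⇒m/n≡0 (toℕ<n r)) (m*n/n≡m q m))

  label-run-digits-0 : ∀ L v → label D (run D v (digits L 0)) ≡ label D v
  label-run-digits-0 zero    v = refl
  label-run-digits-0 (suc L) v = begin
    label D (run D v₀ (digits L (0 / m))) ≡⟨ cong (λ k → label D (run D v₀ (digits L k))) (0/n≡0 m) ⟩
    label D (run D v₀ (digits L 0))       ≡⟨ label-run-digits-0 L v₀ ⟩
    label D v₀                            ≡⟨ zeroInv D v _ (trans (toℕ-fromℕ< _) 0%m≡0) ⟩
    label D v                             ∎
    where
    open ≡-Reasoning
    v₀ = δ D v (digit D 0)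
    0%m≡0 : 0 % m ≡ 0
    0%m≡0 = m<n⇒m%n≡m (>-nonZero⁻¹ m)

  nonzeroAt : Fin n → ℕ → ℕ → ℕ
  nonzeroAt v L k = [ label D (run D v (digits L k)) ≢0]

  #nonzeroWalks≡sumBelow : ∀ L v → #nonzeroWalks v L ≡ sumBelow (m ^ L) (nonzeroAt v L)
  #nonzeroWalks≡sumBelow zero    v = sym (+-identityʳ _)
  #nonzeroWalks≡sumBelow (suc L) v = sym (begin
    sumBelow (m * m ^ L) (nonzeroAt v (suc L))
      ≡⟨ cong (λ M → sumBelow M (nonzeroAt v (suc L))) (*-comm m (m ^ L)) ⟩
    sumBelow (m ^ L * m) (nonzeroAt v (suc L))
      ≡⟨ sumBelow-* (m ^ L) m (nonzeroAt v (suc L)) ⟩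
    ∑[ r < m ] sumBelow (m ^ L) (λ q → nonzeroAt v (suc L) (toℕ r + q * m))
      ≡⟨ sum-cong-≗ {m} (λ r → sumBelow-cong (m ^ L) λ q _ →
           cong₂ (λ d k → nonzeroAt (δ D v d) L k) (digit-+* r q) (/-+* r q)) ⟩
    ∑[ r < m ] sumBelow (m ^ L) (nonzeroAt (δ D v r) L)
      ≡⟨ sum-cong-≗ {m} (λ r → #nonzeroWalks≡sumBelow L (δ D v r)) ⟨
    ∑[ r < m ] #nonzeroWalks (δ D v r) L ∎)
    where open ≡-Reasoning

  countE-suc : ∀ N → countE D (suc N) ≡ countE D N + [ seqA D (suc N) ≢0]
  countE-suc N with seqA D (suc N) Fin.≟ zero
  ... | yes aₙ≡0 = sym (trans (cong (λ c → countE D N + [ c ≢0]) aₙ≡0) (+-identityʳ _))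
  ... | no  aₙ≢0 = trans (+-comm 1 _) (cong (countE D N +_) (sym ([≢0]≡1 aₙ≢0)))

  countE≡sumBelow : ∀ N → countE D N ≡ sumBelow N ([_≢0] ∘ seqA D ∘ suc)
  countE≡sumBelow zero    = refl
  countE≡sumBelow (suc N) = begin
    countE D (suc N)                             ≡⟨ countE-suc N ⟩
    countE D N + [ aₙ ≢0]                        ≡⟨ cong (_+ [ aₙ ≢0]) (countE≡sumBelow N) ⟩
    sumBelow N ([_≢0] ∘ seqA D ∘ suc) + [ aₙ ≢0] ≡⟨ sumBelow-suc N ([_≢0] ∘ seqA D ∘ suc) ⟨
    sumBelow (suc N) ([_≢0] ∘ seqA D ∘ suc)      ∎
    where
    open ≡-Reasoning
    aₙ = seqA D (suc N)

  module _ (m≥2 : 2 ≤ m) where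

    label-run-digits : ∀ L f v k → k < m ^ L → k ≤ f →
      label D (run D v (digits L k)) ≡ label D (runDigits D f v k)
    label-run-digits L       zero    v zero    _ _ = label-run-digits-0 L v
    label-run-digits L       (suc f) v zero    _ _ = label-run-digits-0 L v
    label-run-digits zero    f       v (suc k) (s≤s ()) _
    label-run-digits (suc L) (suc f) v (suc k) k<m^L (s≤s k≤f) =
      label-run-digits L f (δ D v (digit D (suc k))) (suc k / m)
        (m<n*o⇒m/o<n (subst (suc k <_) (*-comm m (m ^ L)) k<m^L))
        (≤-pred (≤-trans (m/n<m (suc k) m m≥2) (s≤s k≤f)))

    #nonzeroWalks-start : ∀ L → #nonzeroWalks s₀ L ≡ sumBelow (m ^ L) ([_≢0] ∘ seqA D)
    #nonzeroWalks-start L = trans (#nonzeroWalks≡sumBelow L s₀)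
      (sumBelow-cong (m ^ L) λ k k<m^L → cong [_≢0] (label-run-digits L k s₀ k k<m^L ≤-refl))

    countE≤#nonzeroWalks : ∀ {N L} → suc N ≤ m ^ L → countE D N ≤ #nonzeroWalks s₀ L
    countE≤#nonzeroWalks {N} {L} N<m^L = begin
      countE D N                        ≡⟨ countE≡sumBelow N ⟩
      sumBelow N ([_≢0] ∘ seqA D ∘ suc) ≤⟨ m≤n+m _ _ ⟩
      sumBelow (suc N) ([_≢0] ∘ seqA D) ≤⟨ sumBelow-mono ([_≢0] ∘ seqA D) N<m^L ⟩
      sumBelow (m ^ L) ([_≢0] ∘ seqA D) ≡⟨ #nonzeroWalks-start L ⟨
      #nonzeroWalks s₀ L                ∎
      where open ≤-Reasoning

    #nonzeroWalks≤countE : ∀ {N L} → m ^ L ≤ suc N → #nonzeroWalks s₀ L ≤ suc (countE D N)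
    #nonzeroWalks≤countE {N} {L} m^L≤N+1 = begin
      #nonzeroWalks s₀ L                        ≡⟨ #nonzeroWalks-start L ⟩
      sumBelow (m ^ L) ([_≢0] ∘ seqA D)         ≤⟨ sumBelow-mono ([_≢0] ∘ seqA D) m^L≤N+1 ⟩
      [ a₀ ≢0] + sumBelow N ([_≢0] ∘ seqA D ∘ suc) ≡⟨ cong ([ a₀ ≢0] +_) (countE≡sumBelow N) ⟨
      [ a₀ ≢0] + countE D N                     ≤⟨ +-monoˡ-≤ (countE D N) ([≢0]≤1 a₀) ⟩
      suc (countE D N)                          ∎
      where
      open ≤-Reasoning
      a₀ = seqA D 0

    rootBound⇒polyGrowth : (∃[ q ] 1 ≤ q × ∃[ N₀ ] ∀ N → N₀ ≤ N → N ≤ countE D N ^ q) → PolyGrowth D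
    rootBound⇒polyGrowth (q , q≥1 , N₀ , N≤E^q) = 1 , q , ≤-refl , q≥1 , N₀ , λ N N₀≤N →
      subst (_≤ countE D N ^ q) (sym (^-identityʳ N)) (N≤E^q N N₀≤N)

    tied⇒polyGrowth : AllReachable D → HasTied D → PolyGrowth D
    tied⇒polyGrowth reachable (v , (w , w≢0) , c₁ , c₂ , c₁≢c₂ , |c₁|≡|c₂| , c₁↺ , c₂↺) with reachable v
    ... | u , u↝v =
      rootBound⇒polyGrowth (polyGrowth-from-doubling m≥2 (countE D) (length u + length w) ℓ ℓ≥1 doublingAtScale)
      where
      ℓ = length c₁
      ℓ≥1 : 1 ≤ ℓ
      ℓ≥1 = ≢-sameLength⇒nonempty c₁≢c₂ |c₁|≡|c₂|
      doublingAtScale : ∀ j N → m ^ (length u + length w + j * ℓ) ≤ suc N → 2 ^ j ≤ suc (countE D N)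
      doublingAtScale j N m^L≤N+1 = begin
        2 ^ j
          ≤⟨ doubling w c₁ c₂ w≢0 |c₁|≡|c₂| c₁≢c₂ c₁↺ c₂↺ j ⟩
        #nonzeroWalks v (j * ℓ + length w)
          ≡⟨ cong (λ x → #nonzeroWalks x (j * ℓ + length w)) u↝v ⟨
        #nonzeroWalks (run D s₀ u) (j * ℓ + length w)
          ≤⟨ #nonzeroWalks-run s₀ u (j * ℓ + length w) ⟩
        #nonzeroWalks s₀ (length u + (j * ℓ + length w))
          ≡⟨ cong (#nonzeroWalks s₀) rearrange ⟩
        #nonzeroWalks s₀ (length u + length w + j * ℓ)
          ≤⟨ #nonzeroWalks≤countE {N} {length u + length w + j * ℓ} m^L≤N+1 ⟩
        suc (countE D N) ∎
        where
        open ≤-Reasoning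
        rearrange : length u + (j * ℓ + length w) ≡ length u + length w + j * ℓ
        rearrange = trans (cong (length u +_) (+-comm (j * ℓ) (length w)))
                          (sym (+-assoc (length u) (length w) (j * ℓ)))

    untied⇒sparse : ¬ HasTied D → Sparse D
    untied⇒sparse untied = n , (m * 3) ^ n , 2 , bound
      where
      bound : ∀ N → 2 ≤ N → countE D N ≤ (m * 3) ^ n * ⌊log₂ N ⌋ ^ n
      bound N 2≤N = begin
        countE D N               ≤⟨ countE≤#nonzeroWalks {N} {suc ℓ} N<m^[1+ℓ] ⟩
        #nonzeroWalks s₀ (suc ℓ) ≤⟨ #nonzeroWalks-untied untied n (suc ℓ) s₀ (∣p∣≤n (reachable s₀)) ⟩
        (m * (2 + ℓ)) ^ n        ≤⟨ ^-monoˡ-≤ n (*-monoʳ-≤ m 2+ℓ≤3ℓ) ⟩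
        (m * (3 * ℓ)) ^ n        ≡⟨ cong (_^ n) (*-assoc m 3 ℓ) ⟨
        (m * 3 * ℓ) ^ n          ≡⟨ ^-distribʳ-* (m * 3) ℓ n ⟩
        (m * 3) ^ n * ℓ ^ n      ∎
        where
        open ≤-Reasoning
        ℓ = ⌊log₂ N ⌋
        ℓ≥1 : 1 ≤ ℓ
        ℓ≥1 = subst (_≤ ℓ) (⌊log₂[2^n]⌋≡n 1) (⌊log₂⌋-mono-≤ 2≤N)
        2+ℓ≤3ℓ : 2 + ℓ ≤ 3 * ℓ
        2+ℓ≤3ℓ = ≤-trans (≤-reflexive (+-comm 2 ℓ)) (+-monoʳ-≤ ℓ (*-monoʳ-≤ 2 ℓ≥1))
        N<m^[1+ℓ] : suc N ≤ m ^ suc ℓ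
        N<m^[1+ℓ] = ≤-trans (n<2^[1+⌊log₂n⌋] N) (^-monoˡ-≤ (suc ℓ) m≥2)

mainTheorem1 : (m n a : ℕ) {{_ : NonZero m}} → 2 ≤ m →
    (D : Automaton m n a) → AllReachable D →
    (Case-i D ⊎ Case-ii D) × ¬ (Case-i D × Case-ii D)
mainTheorem1 m n a m≥2 D reachable = dichotomy , exclusive
  where
  dichotomy : Case-i D ⊎ Case-ii D
  dichotomy with hasTied? D
  ... | yes tied   = inj₁ (tied , tied⇒polyGrowth D m≥2 reachable tied)
  ... | no  untied = inj₂ (untied , untied⇒sparse D m≥2 untied)
  exclusive : ¬ (Case-i D × Case-ii D)
  exclusive ((tied , _) , (untied , _)) = untied tied
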